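{- Let $h \geq 1$, $N \geq 1$ be integers, and let $d_1 \geq \dots \geq d_N$ and $d_1' \geq \dots \geq d_N'$ be integers in $[0,h]$. Then $P(d_1, \dots, d_N)(x) \geq P(d_1', \dots, d_N')(x)$ for all real $x \in [0,h]$ if and only if $d_1' + \dots + d_i' \leq d_1 + \dots + d_i$ for all $1 \leq i \leq N$.
   Context: For integers $d_1, \dots, d_N$ between $0$ and $h$, $P(d_1, \dots, d_N)$ is the function on $[0,h]$ given by $P(d_1, \dots, d_N)(x) = \frac{1}{N}\sum_{i=1}^N \max(0, x + d_i - h)$.
   Formalization: The point x ranges over the rationals in $[0,h]$ instead of the reals, and each function $P(d_1, \dots, d_N)$ is taken on the rationals. -}

module Defs where

open import Data.Nat as ℕ using (ℕ; zero; suc)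
open import Data.Fin using (Fin; zero; suc)
open import Data.Integer using (+_)
open import Data.Rational using (ℚ; 0ℚ; _+_; _-_; _*_; _⊔_; _/_)

sumℚ : (n : ℕ) → (Fin n → ℚ) → ℚ
sumℚ zero    f = 0ℚ
sumℚ (suc n) f = f zero + sumℚ n (λ j → f (suc j))

ℕ→ℚ : ℕ → ℚ
ℕ→ℚ k = (+ k) / 1

P : (h N : ℕ) .{{_ : ℕ.NonZero N}} → (Fin N → ℕ) → ℚ → ℚ
P h N d x = ((+ 1) / N) * sumℚ N (λ i → 0ℚ ⊔ ((x + ℕ→ℚ (d i)) - ℕ→ℚ h))

prefixSum : (N : ℕ) → (Fin N → ℕ) → ℕ → ℕ
prefixSum zero    d k       = 0
prefixSum (suc N) d zero    = 0
prefixSum (suc N) d (suc k) = d zero ℕ.+ prefixSum N (λ j → d (suc j)) k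

{-# OPTIONS --safe #-}
-- Write u_j(x) = x + d_j - h (the `hinge` arguments), so N · P(d)(x) = Σ max(0, u_j(x)).
-- When u is non-increasing, this sum of positive parts is the largest prefix sum
-- u_1 + ... + u_k, attained where u changes sign, and that prefix sum equals
-- d_1 + ... + d_k + k (x - h).  So prefix domination of d over d′ gives P d′ ≤ P d at every x.
-- Conversely, at x = h - d_i we have u_j(x) = d_j - d_i, which is non-negative exactly for
-- j ≤ i; there the sum of positive parts for d is its prefix sum of length i, and it bounds
-- the same prefix sum for d′.
module Submission where

open import Defs
open import Data.Nat as ℕ using (ℕ; NonZero; zero; suc; z≤n; s≤s)
import Data.Nat.Properties as ℕ
open import Data.Fin using (Fin; toℕ; fromℕ<) renaming (zero to fzero; suc to fsuc)
import Data.Fin.Properties as Fin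
open import Data.Integer as ℤ using (+_)
import Data.Integer.Properties as ℤ
open import Data.Rational
  using (ℚ; _≤_; 0ℚ; 1ℚ; _+_; _-_; _*_; _⊔_; -_; toℚᵘ; _/_; NonNegative; Positive)
open import Data.Rational.Properties
import Data.Rational.Unnormalised as ℚᵘ
import Data.Rational.Unnormalised.Properties as ℚᵘ
open import Data.Rational.Solver using (module +-*-Solver)
import Data.Nat.Coprimality as Coprime
open import Data.Product using (∃; _×_; _,_)
open import Function.Bundles using (_⇔_; mk⇔)
open import Relation.Binary.PropositionalEquality
open import Relation.Nullary using (yes; no)

open +-*-Solver

toℚᵘ-ℕ→ℚ : ∀ n → toℚᵘ (ℕ→ℚ n) ≡ ℚᵘ.mkℚᵘ (+ n) 0
toℚᵘ-ℕ→ℚ n = cong toℚᵘ (normalize-coprime (Coprime.sym (Coprime.1-coprimeTo n)))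

ℕ→ℚ-mono-≤ : ∀ {m n} → m ℕ.≤ n → ℕ→ℚ m ≤ ℕ→ℚ n
ℕ→ℚ-mono-≤ {m} {n} m≤n = toℚᵘ-cancel-≤ (subst₂ ℚᵘ._≤_ (sym (toℚᵘ-ℕ→ℚ m)) (sym (toℚᵘ-ℕ→ℚ n))
  (ℚᵘ.*≤* (subst₂ ℤ._≤_ (sym (ℤ.*-identityʳ (+ m))) (sym (ℤ.*-identityʳ (+ n))) (ℤ.+≤+ m≤n))))

ℕ→ℚ-cancel-≤ : ∀ {m n} → ℕ→ℚ m ≤ ℕ→ℚ n → m ℕ.≤ n
ℕ→ℚ-cancel-≤ {m} {n} m≤n
  with ℚᵘ.*≤* p ← subst₂ ℚᵘ._≤_ (toℚᵘ-ℕ→ℚ m) (toℚᵘ-ℕ→ℚ n) (toℚᵘ-mono-≤ m≤n)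
  with ℤ.+≤+ q ← subst₂ ℤ._≤_ (ℤ.*-identityʳ (+ m)) (ℤ.*-identityʳ (+ n)) p
  = q

ℕ→ℚ-homo-+ : ∀ m n → ℕ→ℚ (m ℕ.+ n) ≡ ℕ→ℚ m + ℕ→ℚ n
ℕ→ℚ-homo-+ m n = toℚᵘ-injective (begin-equality
  toℚᵘ (ℕ→ℚ (m ℕ.+ n))                    ≡⟨ toℚᵘ-ℕ→ℚ (m ℕ.+ n) ⟩
  ℚᵘ.mkℚᵘ (+ (m ℕ.+ n)) 0                  ≃⟨ ℚᵘ.*≡* (cong (ℤ._* + 1) pos-+-pos) ⟩
  ℚᵘ.mkℚᵘ (+ m) 0 ℚᵘ.+ ℚᵘ.mkℚᵘ (+ n) 0      ≡⟨ cong₂ ℚᵘ._+_ (toℚᵘ-ℕ→ℚ m) (toℚᵘ-ℕ→ℚ n) ⟨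
  toℚᵘ (ℕ→ℚ m) ℚᵘ.+ toℚᵘ (ℕ→ℚ n)          ≃⟨ toℚᵘ-homo-+ (ℕ→ℚ m) (ℕ→ℚ n) ⟨
  toℚᵘ (ℕ→ℚ m + ℕ→ℚ n)                    ∎)
  where
  open ℚᵘ.≤-Reasoning
  pos-+-pos : + (m ℕ.+ n) ≡ + m ℤ.* + 1 ℤ.+ + n ℤ.* + 1
  pos-+-pos = trans (ℤ.pos-+ m n) (sym (cong₂ ℤ._+_ (ℤ.*-identityʳ (+ m)) (ℤ.*-identityʳ (+ n))))

p≤q⇒0≤q-p : ∀ {p q} → p ≤ q → 0ℚ ≤ q - p
p≤q⇒0≤q-p {p} {q} p≤q = subst (_≤ q - p) (+-inverseʳ p) (+-monoˡ-≤ (- p) p≤q)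

p≤q⇒p-q≤0 : ∀ {p q} → p ≤ q → p - q ≤ 0ℚ
p≤q⇒p-q≤0 {p} {q} p≤q = subst (p - q ≤_) (+-inverseʳ q) (+-monoˡ-≤ (- q) p≤q)

0+0*p≡0 : ∀ p → 0ℚ + 0ℚ * p ≡ 0ℚ
0+0*p≡0 p = trans (+-identityˡ (0ℚ * p)) (*-zeroˡ p)

+-cancelʳ-≤ : ∀ r {p q} → p + r ≤ q + r → p ≤ q
+-cancelʳ-≤ r {p} {q} p+r≤q+r = subst₂ _≤_ (t+r-r≡t p) (t+r-r≡t q) (+-monoˡ-≤ (- r) p+r≤q+r)
  where
  t+r-r≡t : ∀ t → (t + r) - r ≡ t
  t+r-r≡t t = solve 2 (λ t r → (t :+ r) :- r := t) refl t r

prefixSumℚ : (n : ℕ) → (Fin n → ℚ) → ℕ → ℚ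
prefixSumℚ zero    f k       = 0ℚ
prefixSumℚ (suc n) f zero    = 0ℚ
prefixSumℚ (suc n) f (suc k) = f fzero + prefixSumℚ n (λ j → f (fsuc j)) k

positivePartSum : (n : ℕ) → (Fin n → ℚ) → ℚ
positivePartSum n f = sumℚ n (λ j → 0ℚ ⊔ f j)

positivePartSum-nonNeg : ∀ n f → 0ℚ ≤ positivePartSum n f
positivePartSum-nonNeg zero    f = ≤-refl
positivePartSum-nonNeg (suc n) f =
  +-mono-≤ (p≤p⊔q 0ℚ (f fzero)) (positivePartSum-nonNeg n (λ j → f (fsuc j)))

prefixSumℚ≤positivePartSum : ∀ n f k → prefixSumℚ n f k ≤ positivePartSum n f
prefixSumℚ≤positivePartSum zero    f k       = ≤-refl
prefixSumℚ≤positivePartSum (suc n) f zero    = positivePartSum-nonNeg (suc n) f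
prefixSumℚ≤positivePartSum (suc n) f (suc k) =
  +-mono-≤ (p≤q⊔p 0ℚ (f fzero)) (prefixSumℚ≤positivePartSum n (λ j → f (fsuc j)) k)

prefixSumℚ-zero : ∀ n f → prefixSumℚ n f 0 ≡ 0ℚ
prefixSumℚ-zero zero    f = refl
prefixSumℚ-zero (suc n) f = refl

prefixSum-zero : ∀ n (d : Fin n → ℕ) → prefixSum n d 0 ≡ 0
prefixSum-zero zero    d = refl
prefixSum-zero (suc n) d = refl

positivePartSum≡prefixSumℚ : ∀ n f k →
  (∀ j → toℕ j ℕ.< k → 0ℚ ≤ f j) → (∀ j → k ℕ.≤ toℕ j → f j ≤ 0ℚ) →
  positivePartSum n f ≡ prefixSumℚ n f k
positivePartSum≡prefixSumℚ zero    f k       nonNeg nonPos = refl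
positivePartSum≡prefixSumℚ (suc n) f zero    nonNeg nonPos = begin
  0ℚ ⊔ f fzero + positivePartSum n (λ j → f (fsuc j))
    ≡⟨ cong₂ _+_ (p≥q⇒p⊔q≡p (nonPos fzero z≤n)) tail≡0 ⟩
  0ℚ + 0ℚ
    ≡⟨ +-identityˡ 0ℚ ⟩
  0ℚ ∎
  where
  open ≡-Reasoning
  tail≡0 : positivePartSum n (λ j → f (fsuc j)) ≡ 0ℚ
  tail≡0 = trans
    (positivePartSum≡prefixSumℚ n (λ j → f (fsuc j)) 0 (λ _ ()) (λ j _ → nonPos (fsuc j) z≤n))
    (prefixSumℚ-zero n _)
positivePartSum≡prefixSumℚ (suc n) f (suc k) nonNeg nonPos =
  cong₂ _+_ (p≤q⇒p⊔q≡q (nonNeg fzero (s≤s z≤n)))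
    (positivePartSum≡prefixSumℚ n (λ j → f (fsuc j)) k
      (λ j j<k → nonNeg (fsuc j) (s≤s j<k)) (λ j k≤j → nonPos (fsuc j) (s≤s k≤j)))

antitone⇒positivePartSum≡prefixSumℚ : ∀ n f → (∀ i j → i Data.Fin.≤ j → f j ≤ f i) →
  ∃ λ k → k ℕ.≤ n × positivePartSum n f ≡ prefixSumℚ n f k
antitone⇒positivePartSum≡prefixSumℚ zero f antitone = 0 , z≤n , refl
antitone⇒positivePartSum≡prefixSumℚ (suc n) f antitone with f fzero ≤? 0ℚ
... | yes f₀≤0 = 0 , z≤n ,
  positivePartSum≡prefixSumℚ (suc n) f 0 (λ _ ()) (λ j _ → ≤-trans (antitone fzero j z≤n) f₀≤0)
... | no f₀≰0
  with k , k≤n , eq ← antitone⇒positivePartSum≡prefixSumℚ n (λ j → f (fsuc j))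
                        (λ i j i≤j → antitone (fsuc i) (fsuc j) (s≤s i≤j))
  = suc k , s≤s k≤n , cong₂ _+_ (p≤q⇒p⊔q≡q (<⇒≤ (≰⇒> f₀≰0))) eq

hinge : ∀ {n} → ℕ → (Fin n → ℕ) → ℚ → Fin n → ℚ
hinge h d x j = (x + ℕ→ℚ (d j)) - ℕ→ℚ h

prefixSumℚ-hinge : ∀ h n (d : Fin n → ℕ) x k → k ℕ.≤ n →
  prefixSumℚ n (hinge h d x) k ≡ ℕ→ℚ (prefixSum n d k) + ℕ→ℚ k * (x - ℕ→ℚ h)
prefixSumℚ-hinge h zero    d x zero    z≤n = sym (0+0*p≡0 (x - ℕ→ℚ h))
prefixSumℚ-hinge h (suc n) d x zero    z≤n = sym (0+0*p≡0 (x - ℕ→ℚ h))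
prefixSumℚ-hinge h (suc n) d x (suc k) (s≤s k≤n) = begin
  (x + D₀) - H + prefixSumℚ n (hinge h (λ j → d (fsuc j)) x) k
    ≡⟨ cong (_+_ ((x + D₀) - H)) (prefixSumℚ-hinge h n (λ j → d (fsuc j)) x k k≤n) ⟩
  (x + D₀) - H + (Dₖ + K * (x - H))
    ≡⟨ solve 5 (λ x D₀ H Dₖ K → (x :+ D₀) :- H :+ (Dₖ :+ K :* (x :- H))
                                := (D₀ :+ Dₖ) :+ (con 1ℚ :+ K) :* (x :- H)) refl x D₀ H Dₖ K ⟩
  (D₀ + Dₖ) + (1ℚ + K) * (x - H)
    ≡⟨ cong₂ (λ a b → a + b * (x - H)) (ℕ→ℚ-homo-+ (d fzero) _) (ℕ→ℚ-homo-+ 1 k) ⟨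
  ℕ→ℚ (d fzero ℕ.+ prefixSum n (λ j → d (fsuc j)) k) + ℕ→ℚ (suc k) * (x - H) ∎
  where
  open ≡-Reasoning
  H  = ℕ→ℚ h
  D₀ = ℕ→ℚ (d fzero)
  Dₖ = ℕ→ℚ (prefixSum n (λ j → d (fsuc j)) k)
  K  = ℕ→ℚ k

module _ (h N : ℕ) .{{_ : NonZero N}} (d d′ : Fin N → ℕ) where

  private instance
    1/N-nonNeg : NonNegative (+ 1 / N)
    1/N-nonNeg = normalize-nonNeg 1 N
    1/N-pos : Positive (+ 1 / N)
    1/N-pos = normalize-pos 1 N

  prefixSum-≤⇒P-≤ : (∀ i j → i Data.Fin.≤ j → d′ j ℕ.≤ d′ i) →
    (∀ k → k ℕ.≤ N → prefixSum N d′ k ℕ.≤ prefixSum N d k) →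
    ∀ x → P h N d′ x ≤ P h N d x
  prefixSum-≤⇒P-≤ antitone′ prefix-≤ x
    with k , k≤N , eq ← antitone⇒positivePartSum≡prefixSumℚ N (hinge h d′ x)
           (λ i j i≤j → +-monoˡ-≤ (- ℕ→ℚ h) (+-monoʳ-≤ x (ℕ→ℚ-mono-≤ (antitone′ i j i≤j))))
    = *-monoˡ-≤-nonNeg (+ 1 / N) (begin
      positivePartSum N (hinge h d′ x)                ≡⟨ eq ⟩
      prefixSumℚ N (hinge h d′ x) k                   ≡⟨ prefixSumℚ-hinge h N d′ x k k≤N ⟩
      ℕ→ℚ (prefixSum N d′ k) + ℕ→ℚ k * (x - ℕ→ℚ h)    ≤⟨ +-monoˡ-≤ _ (ℕ→ℚ-mono-≤ (prefix-≤ k k≤N)) ⟩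
      ℕ→ℚ (prefixSum N d k) + ℕ→ℚ k * (x - ℕ→ℚ h)     ≡⟨ prefixSumℚ-hinge h N d x k k≤N ⟨
      prefixSumℚ N (hinge h d x) k                    ≤⟨ prefixSumℚ≤positivePartSum N (hinge h d x) k ⟩
      positivePartSum N (hinge h d x)                 ∎)
    where open ≤-Reasoning

  P-≤⇒prefixSum-≤ : (∀ i j → i Data.Fin.≤ j → d j ℕ.≤ d i) → (∀ j → d j ℕ.≤ h) →
    (∀ x → 0ℚ ≤ x → x ≤ ℕ→ℚ h → P h N d′ x ≤ P h N d x) →
    ∀ j → prefixSum N d′ (suc (toℕ j)) ℕ.≤ prefixSum N d (suc (toℕ j))
  P-≤⇒prefixSum-≤ antitone d≤h P-≤ j = ℕ→ℚ-cancel-≤ (+-cancelʳ-≤ (K * (x - H)) (begin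
    ℕ→ℚ (prefixSum N d′ k) + K * (x - H) ≡⟨ prefixSumℚ-hinge h N d′ x k k≤N ⟨
    prefixSumℚ N (hinge h d′ x) k       ≤⟨ prefixSumℚ≤positivePartSum N (hinge h d′ x) k ⟩
    positivePartSum N (hinge h d′ x)    ≤⟨ *-cancelˡ-≤-pos (+ 1 / N) (P-≤ x 0≤x x≤H) ⟩
    positivePartSum N (hinge h d x)     ≡⟨ positivePartSum≡prefixSumℚ N (hinge h d x) k nonNeg nonPos ⟩
    prefixSumℚ N (hinge h d x) k        ≡⟨ prefixSumℚ-hinge h N d x k k≤N ⟩
    ℕ→ℚ (prefixSum N d k) + K * (x - H) ∎))
    where
    open ≤-Reasoning
    k = suc (toℕ j)
    k≤N = Fin.toℕ<n j
    K = ℕ→ℚ k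
    H = ℕ→ℚ h
    c = ℕ→ℚ (d j)
    x = H - c
    0≤x : 0ℚ ≤ x
    0≤x = p≤q⇒0≤q-p (ℕ→ℚ-mono-≤ (d≤h j))
    x≤H : x ≤ H
    x≤H = subst (x ≤_) (+-identityʳ H) (+-monoʳ-≤ H (neg-antimono-≤ (ℕ→ℚ-mono-≤ {0} {d j} z≤n)))
    hinge-at-x : ∀ l → hinge h d x l ≡ ℕ→ℚ (d l) - c
    hinge-at-x l = solve 3 (λ H c D → (H :- c :+ D) :- H := D :- c) refl H c (ℕ→ℚ (d l))
    nonNeg : ∀ l → toℕ l ℕ.< k → 0ℚ ≤ hinge h d x l
    nonNeg l (s≤s l≤j) =
      subst (0ℚ ≤_) (sym (hinge-at-x l)) (p≤q⇒0≤q-p (ℕ→ℚ-mono-≤ (antitone l j l≤j)))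
    nonPos : ∀ l → k ℕ.≤ toℕ l → hinge h d x l ≤ 0ℚ
    nonPos l j<l =
      subst (_≤ 0ℚ) (sym (hinge-at-x l)) (p≤q⇒p-q≤0 (ℕ→ℚ-mono-≤ (antitone j l (ℕ.<⇒≤ j<l))))

mainTheorem2 : (h N : ℕ) .{{_ : NonZero N}} → 1 ℕ.≤ h →
    (d d′ : Fin N → ℕ) →
    (∀ i j → i Data.Fin.≤ j → d j ℕ.≤ d i) →
    (∀ i j → i Data.Fin.≤ j → d′ j ℕ.≤ d′ i) →
    (∀ i → d i ℕ.≤ h) → (∀ i → d′ i ℕ.≤ h) →
    ((∀ (x : ℚ) → 0ℚ ≤ x → x ≤ ℕ→ℚ h → P h N d′ x ≤ P h N d x)
      ⇔ (∀ (i : ℕ) → 1 ℕ.≤ i → i ℕ.≤ N → prefixSum N d′ i ℕ.≤ prefixSum N d i))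
mainTheorem2 h N _ d d′ antitone antitone′ d≤h _ = mk⇔ to from
  where
  to : (∀ x → 0ℚ ≤ x → x ≤ ℕ→ℚ h → P h N d′ x ≤ P h N d x) →
       ∀ i → 1 ℕ.≤ i → i ℕ.≤ N → prefixSum N d′ i ℕ.≤ prefixSum N d i
  to P-≤ (suc i) _ i<N = subst (λ k → prefixSum N d′ k ℕ.≤ prefixSum N d k)
    (cong suc (Fin.toℕ-fromℕ< i<N)) (P-≤⇒prefixSum-≤ h N d d′ antitone d≤h P-≤ (fromℕ< i<N))
  from : (∀ i → 1 ℕ.≤ i → i ℕ.≤ N → prefixSum N d′ i ℕ.≤ prefixSum N d i) →
         ∀ x → 0ℚ ≤ x → x ≤ ℕ→ℚ h → P h N d′ x ≤ P h N d x
  from prefix-≤ x _ _ = prefixSum-≤⇒P-≤ h N d d′ antitone′ prefix-≤′ x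
    where
    prefix-≤′ : ∀ k → k ℕ.≤ N → prefixSum N d′ k ℕ.≤ prefixSum N d k
    prefix-≤′ zero    _   = subst (ℕ._≤ prefixSum N d 0) (sym (prefixSum-zero N d′)) z≤n
    prefix-≤′ (suc k) k<N = prefix-≤ (suc k) (s≤s z≤n) k<N
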